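{- Let $q\in(0,1)$ and let $G=(V,E)$ be a graph with $n=|V|$ vertices. Suppose $(A,B)$ is a $(1-q)$-external partition of $G$ with $|A|=qn$ and $|B|=(1-q)n$, and suppose that $q\,d_{\bar G}(v)$ is an integer for every $v\in V$. Then $(A,B)$ is a $q$-internal partition of the complement $\bar G$ (with $|A|=qn$).
   Context: Graphs are finite and simple; $\bar G$ is the complement graph of $G$, and $d_{\bar G}(v)$ is the degree of $v$ in $\bar G$. For $S\subseteq V$ and $v\in V$, $d_S(v)$ is the number of neighbors of $v$ in $S$ (in the graph under consideration) and $d_H(v)$ the degree of $v$ in a graph $H$. In a graph $H$ on $V$, a partition $(A,B)$ of $V$ (with $A,B$ nonempty) is $q$-internal if $d_A(x)\ge q\,d_H(x)$ for all $x\in A$ and $d_B(x)\ge(1-q)\,d_H(x)$ for all $x\in B$; it is $p$-external if $d_B(x)\ge p\,d_H(x)$ for all $x\in A$ and $d_A(x)\ge(1-p)\,d_H(x)$ for all $x\in B$. -}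

module Defs where

open import Data.Bool using (Bool; true; false; not; _∧_)
open import Data.Nat using (ℕ; zero; suc; _+_)
open import Data.Fin using (Fin; _≟_)
import Data.Fin as Fin
open import Data.Integer using (ℤ; +_)
open import Data.Rational using (ℚ; _/_; _*_; _≤_; _<_; _-_; 0ℚ; 1ℚ)
open import Data.Product using (Σ; ∃; _×_)
open import Relation.Binary.PropositionalEquality using (_≡_)
open import Relation.Nullary.Decidable using (⌊_⌋)

Adj : ℕ → Set
Adj n = Fin n → Fin n → Bool

record IsSimple {n : ℕ} (G : Adj n) : Set where
  field
    sym     : ∀ u v → G u v ≡ G v u
    irrefl  : ∀ v → G v v ≡ false

complement : ∀ {n} → Adj n → Adj n
complement G u v = not (G u v) ∧ not ⌊ u ≟ v ⌋

count : ∀ {n} → (Fin n → Bool) → ℕ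
count {zero}  P = 0
count {suc n} P = (if-one (P Fin.zero)) + count (λ i → P (Fin.suc i))
  where
  if-one : Bool → ℕ
  if-one true  = 1
  if-one false = 0

Subset : ℕ → Set
Subset n = Fin n → Bool

degIn : ∀ {n} → Adj n → Subset n → Fin n → ℕ
degIn H S v = count (λ u → S u ∧ H v u)

deg : ∀ {n} → Adj n → Fin n → ℕ
deg H v = count (λ u → H v u)

toℚ : ℕ → ℚ
toℚ k = + k / 1

-- A partition (A, B) of V = Fin n is given by A; B is its complement.
-- Both parts must be nonempty.
compl : ∀ {n} → Subset n → Subset n
compl A v = not (A v)

NonemptyParts : ∀ {n} → Subset n → Set
NonemptyParts A = (∃ λ x → A x ≡ true) × (∃ λ x → A x ≡ false)

IsInternal : ∀ {n} → ℚ → Adj n → Subset n → Set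
IsInternal q H A =
  NonemptyParts A ×
  (∀ x → A x ≡ true  → q * toℚ (deg H x) ≤ toℚ (degIn H A x)) ×
  (∀ x → A x ≡ false → (1ℚ - q) * toℚ (deg H x) ≤ toℚ (degIn H (compl A) x))

IsExternal : ∀ {n} → ℚ → Adj n → Subset n → Set
IsExternal p H A =
  NonemptyParts A ×
  (∀ x → A x ≡ true  → p * toℚ (deg H x) ≤ toℚ (degIn H (compl A) x)) ×
  (∀ x → A x ≡ false → (1ℚ - p) * toℚ (deg H x) ≤ toℚ (degIn H A x))

IsInteger : ℚ → Set
IsInteger r = Σ ℤ λ k → r ≡ k / 1

-- At a vertex x of a side S with |S| = p n, the degrees of x in G and in its complement add up
-- to n − 1, and its degrees into S to |S| − 1. Writing D and c for the complement degree of x and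
-- its complement degree into S, the external inequality (1 − p) d_G(x) ≤ d_{V∖S}(x) therefore
-- rearranges to p D ≤ c + (1 − p) < c + 1, and integrality of p D forces p D ≤ c. Side A is the
-- case p = q; side B is the case p = 1 − q, where (1 − q) D = D − q D is again an integer.
module Submission where

open import Defs
open import Data.Bool using (Bool; true; false; not; _∧_)
open import Data.Bool.Properties using (not-involutive; ∧-zeroʳ)
open import Data.Fin using (Fin; _≟_)
import Data.Fin as Fin
open import Data.Integer as ℤ using (ℤ; +_; -[1+_]; +≤+; +<+; -≤+)
import Data.Integer.Properties as ℤP
open import Data.Nat as ℕ using (ℕ; zero; suc; s≤s)
import Data.Nat.Properties as ℕP
open import Function using (_∘_)
open import Algebra.Properties.CommutativeSemigroup ℕP.+-commutativeSemigroup
  using () renaming (interchange to +-interchange)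
open import Data.Product using (_×_; _,_)
open import Data.Rational
  using (ℚ; _/_; _+_; _-_; -_; _*_; _≤_; _<_; 0ℚ; 1ℚ; toℚᵘ)
open import Data.Rational.Properties
  using ( toℚᵘ-injective; toℚᵘ-fromℚᵘ; toℚᵘ-homo-+; toℚᵘ-mono-<; toℚᵘ-cancel-≤
        ; +-monoʳ-≤; +-monoˡ-≤; +-monoʳ-<; +-monoˡ-<; neg-antimono-<; +-inverseʳ
        ; module ≤-Reasoning)
open import Data.Rational.Solver using (module +-*-Solver)
import Data.Rational.Unnormalised as ℚᵘ
import Data.Rational.Unnormalised.Properties as ℚᵘP
open import Relation.Binary.PropositionalEquality
open import Relation.Nullary using (yes; no)
open import Relation.Nullary.Decidable using (⌊_⌋; ⌊⌋-map′)

open +-*-Solver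

fromℤ : ℤ → ℚ
fromℤ i = i / 1

fromℤ≃mkℚᵘ : ∀ i → toℚᵘ (fromℤ i) ℚᵘ.≃ ℚᵘ.mkℚᵘ i 0
fromℤ≃mkℚᵘ i = toℚᵘ-fromℚᵘ (ℚᵘ.mkℚᵘ i 0)

fromℤ-+ : ∀ i j → fromℤ (i ℤ.+ j) ≡ fromℤ i + fromℤ j
fromℤ-+ i j = toℚᵘ-injective (begin
  toℚᵘ (fromℤ (i ℤ.+ j))                ≈⟨ fromℤ≃mkℚᵘ (i ℤ.+ j) ⟩
  ℚᵘ.mkℚᵘ (i ℤ.+ j) 0                   ≈⟨ ℚᵘ.*≡* (identity i j) ⟩
  ℚᵘ.mkℚᵘ i 0 ℚᵘ.+ ℚᵘ.mkℚᵘ j 0          ≈⟨ ℚᵘP.+-cong (fromℤ≃mkℚᵘ i) (fromℤ≃mkℚᵘ j) ⟨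
  toℚᵘ (fromℤ i) ℚᵘ.+ toℚᵘ (fromℤ j)    ≈⟨ toℚᵘ-homo-+ (fromℤ i) (fromℤ j) ⟨
  toℚᵘ (fromℤ i + fromℤ j)              ∎)
  where
  open ℚᵘP.≃-Reasoning
  identity : ∀ a b → (a ℤ.+ b) ℤ.* + 1 ≡ (a ℤ.* + 1 ℤ.+ b ℤ.* + 1) ℤ.* + 1
  identity a b = trans (ℤP.*-identityʳ (a ℤ.+ b)) (sym (trans (ℤP.*-identityʳ _)
    (cong₂ ℤ._+_ (ℤP.*-identityʳ a) (ℤP.*-identityʳ b))))

fromℤ-- : ∀ i j → fromℤ (i ℤ.- j) ≡ fromℤ i - fromℤ j
fromℤ-- i j = begin
  fromℤ (i ℤ.- j)                      ≡⟨ solve 2 (λ a b → a := (a :+ b) :- b) refl (fromℤ (i ℤ.- j)) (fromℤ j) ⟩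
  fromℤ (i ℤ.- j) + fromℤ j - fromℤ j  ≡⟨ cong (_- fromℤ j) (fromℤ-+ (i ℤ.- j) j) ⟨
  fromℤ (i ℤ.- j ℤ.+ j) - fromℤ j      ≡⟨ cong (λ k → fromℤ k - fromℤ j) minus-plus ⟩
  fromℤ i - fromℤ j                    ∎
  where
  open ≡-Reasoning
  minus-plus : i ℤ.- j ℤ.+ j ≡ i
  minus-plus = trans (ℤP.+-assoc i (ℤ.- j) j)
    (trans (cong (ℤ._+_ i) (ℤP.+-inverseˡ j)) (ℤP.+-identityʳ i))

fromℤ-cancel-< : ∀ {i j} → fromℤ i < fromℤ j → i ℤ.< j
fromℤ-cancel-< {i} {j} p
  with ℚᵘP.<-respˡ-≃ (fromℤ≃mkℚᵘ i) (ℚᵘP.<-respʳ-≃ (fromℤ≃mkℚᵘ j) (toℚᵘ-mono-< p))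
... | ℚᵘ.*<* i*1<j*1 = subst₂ ℤ._<_ (ℤP.*-identityʳ i) (ℤP.*-identityʳ j) i*1<j*1

fromℤ-mono-≤ : ∀ {i j} → i ℤ.≤ j → fromℤ i ≤ fromℤ j
fromℤ-mono-≤ {i} {j} i≤j = toℚᵘ-cancel-≤
  (ℚᵘP.≤-respˡ-≃ (ℚᵘP.≃-sym (fromℤ≃mkℚᵘ i)) (ℚᵘP.≤-respʳ-≃ (ℚᵘP.≃-sym (fromℤ≃mkℚᵘ j))
    (ℚᵘ.*≤* (subst₂ ℤ._≤_ (sym (ℤP.*-identityʳ i)) (sym (ℤP.*-identityʳ j)) i≤j))))

toℚ-+ : ∀ m n → toℚ (m ℕ.+ n) ≡ toℚ m + toℚ n
toℚ-+ m n = fromℤ-+ (+ m) (+ n)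

integer-<-suc⇒≤ : ∀ {r} c → IsInteger r → r < toℚ (suc c) → r ≤ toℚ c
integer-<-suc⇒≤ c (k , refl) r<1+c = fromℤ-mono-≤ (<-suc⇒≤ k (fromℤ-cancel-< r<1+c))
  where
  <-suc⇒≤ : ∀ k → k ℤ.< + suc c → k ℤ.≤ + c
  <-suc⇒≤ (+ m)    (+<+ (s≤s m≤c)) = +≤+ m≤c
  <-suc⇒≤ -[1+ m ] _               = -≤+

isInteger-[1-q]*n : ∀ q d → IsInteger (q * toℚ d) → IsInteger ((1ℚ - q) * toℚ d)
isInteger-[1-q]*n q d (k , q*d≡k) = + d ℤ.- k , (begin
  (1ℚ - q) * toℚ d      ≡⟨ solve 2 (λ q d → (con 1ℚ :- q) :* d := d :- q :* d) refl q (toℚ d) ⟩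
  toℚ d - q * toℚ d     ≡⟨ cong (λ x → toℚ d - x) q*d≡k ⟩
  toℚ d - fromℤ k       ≡⟨ fromℤ-- (+ d) k ⟨
  fromℤ (+ d ℤ.- k)     ∎)
  where open ≡-Reasoning

indicator : Bool → ℕ
indicator true  = 1
indicator false = 0

count-suc : ∀ {n} (P : Fin (suc n) → Bool) →
            count P ≡ indicator (P Fin.zero) ℕ.+ count (λ i → P (Fin.suc i))
count-suc P with P Fin.zero
... | true  = refl
... | false = refl

count-cong : ∀ {n} {P Q : Fin n → Bool} → (∀ u → P u ≡ Q u) → count P ≡ count Q
count-cong {zero}          P≗Q = refl
count-cong {suc n} {P} {Q} P≗Q = begin
  count P                                            ≡⟨ count-suc P ⟩
  indicator (P Fin.zero) ℕ.+ count (P ∘ Fin.suc)     ≡⟨ cong₂ ℕ._+_ (cong indicator (P≗Q Fin.zero))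
                                                                     (count-cong (P≗Q ∘ Fin.suc)) ⟩
  indicator (Q Fin.zero) ℕ.+ count (Q ∘ Fin.suc)     ≡⟨ count-suc Q ⟨
  count Q                                            ∎
  where open ≡-Reasoning

count-additive : ∀ {n} (P Q R : Fin n → Bool) →
                 (∀ u → indicator (P u) ℕ.+ indicator (Q u) ≡ indicator (R u)) →
                 count P ℕ.+ count Q ≡ count R
count-additive {zero}  P Q R P+Q≗R = refl
count-additive {suc n} P Q R P+Q≗R = begin
  count P ℕ.+ count Q
    ≡⟨ cong₂ ℕ._+_ (count-suc P) (count-suc Q) ⟩
  (p₀ ℕ.+ count (P ∘ Fin.suc)) ℕ.+ (q₀ ℕ.+ count (Q ∘ Fin.suc))
    ≡⟨ +-interchange p₀ (count (P ∘ Fin.suc)) q₀ (count (Q ∘ Fin.suc)) ⟩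
  (p₀ ℕ.+ q₀) ℕ.+ (count (P ∘ Fin.suc) ℕ.+ count (Q ∘ Fin.suc))
    ≡⟨ cong₂ ℕ._+_ (P+Q≗R Fin.zero) (count-additive _ _ _ (P+Q≗R ∘ Fin.suc)) ⟩
  indicator (R Fin.zero) ℕ.+ count (R ∘ Fin.suc)
    ≡⟨ count-suc R ⟨
  count R ∎
  where
  open ≡-Reasoning
  p₀ = indicator (P Fin.zero)
  q₀ = indicator (Q Fin.zero)

count-false : ∀ n → count {n} (λ _ → false) ≡ 0
count-false zero    = refl
count-false (suc n) = count-false n

count-true : ∀ n → count {n} (λ _ → true) ≡ n
count-true zero    = refl
count-true (suc n) = cong suc (count-true n)

count-∧-split : ∀ {n} (S P : Fin n → Bool) →
                count (λ u → S u ∧ P u) ℕ.+ count (λ u → not (S u) ∧ P u) ≡ count P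
count-∧-split S P = count-additive _ _ _ (λ u → split (S u) (P u))
  where
  split : ∀ s p → indicator (s ∧ p) ℕ.+ indicator (not s ∧ p) ≡ indicator p
  split true  p = ℕP.+-identityʳ (indicator p)
  split false p = refl

count-singleton : ∀ {n} (x : Fin n) (S : Fin n → Bool) → count (λ u → ⌊ x ≟ u ⌋ ∧ S u) ≡ indicator (S x)
count-singleton {suc n} Fin.zero S = begin
  count (λ u → ⌊ Fin.zero ≟ u ⌋ ∧ S u)                ≡⟨ count-suc (λ u → ⌊ Fin.zero ≟ u ⌋ ∧ S u) ⟩
  indicator (S Fin.zero) ℕ.+ count {n} (λ _ → false)  ≡⟨ cong (indicator (S Fin.zero) ℕ.+_) (count-false n) ⟩
  indicator (S Fin.zero) ℕ.+ 0                        ≡⟨ ℕP.+-identityʳ _ ⟩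
  indicator (S Fin.zero)                              ∎
  where open ≡-Reasoning
count-singleton {suc n} (Fin.suc x) S =
  trans (count-cong (λ u → cong (_∧ S (Fin.suc u)) (⌊⌋-map′ _ _ (x ≟ u))))
        (count-singleton x (S ∘ Fin.suc))

degIn-complement : ∀ {n} (G : Adj n) x → G x x ≡ false → (S : Subset n) →
                   degIn (complement G) S x ℕ.+ degIn G S x ℕ.+ indicator (S x) ≡ count S
degIn-complement G x loopless S = begin
  degIn (complement G) S x ℕ.+ degIn G S x ℕ.+ indicator (S x)
    ≡⟨ cong₂ ℕ._+_ (count-additive _ _ _ (λ u → trichotomy (S u) (G x u) ⌊ x ≟ u ⌋ (loop u)))
                   (sym (count-singleton x S)) ⟩
  count (λ u → not ⌊ x ≟ u ⌋ ∧ S u) ℕ.+ count (λ u → ⌊ x ≟ u ⌋ ∧ S u)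
    ≡⟨ ℕP.+-comm (count (λ u → not ⌊ x ≟ u ⌋ ∧ S u)) _ ⟩
  count (λ u → ⌊ x ≟ u ⌋ ∧ S u) ℕ.+ count (λ u → not ⌊ x ≟ u ⌋ ∧ S u)
    ≡⟨ count-∧-split (λ u → ⌊ x ≟ u ⌋) S ⟩
  count S ∎
  where
  open ≡-Reasoning
  loop : ∀ u → ⌊ x ≟ u ⌋ ≡ true → G x u ≡ false
  loop u x≡u with x ≟ u
  loop u x≡u | yes refl = loopless
  loop u ()  | no _
  -- u is a non-neighbour, a neighbour, or x itself, and the last two exclude each other
  trichotomy : ∀ s g e → (e ≡ true → g ≡ false) →
               indicator (s ∧ (not g ∧ not e)) ℕ.+ indicator (s ∧ g) ≡ indicator (not e ∧ s)
  trichotomy false g     e     _ = sym (cong indicator (∧-zeroʳ (not e)))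
  trichotomy true  true  true  h with () ← h refl
  trichotomy true  true  false _ = refl
  trichotomy true  false true  _ = refl
  trichotomy true  false false _ = refl

deg-complement : ∀ {n} (G : Adj n) x → G x x ≡ false → deg (complement G) x ℕ.+ deg G x ℕ.+ 1 ≡ n
deg-complement {n} G x loopless = trans (degIn-complement G x loopless (λ _ → true)) (count-true n)

degIn-complement-own : ∀ {n} (G : Adj n) x → G x x ≡ false → (S : Subset n) → S x ≡ true →
                       degIn (complement G) S x ℕ.+ degIn G S x ℕ.+ 1 ≡ count S
degIn-complement-own G x loopless S x∈S =
  subst (λ b → degIn (complement G) S x ℕ.+ degIn G S x ℕ.+ indicator b ≡ count S) x∈S
        (degIn-complement G x loopless S)

degIn-split : ∀ {n} (G : Adj n) (S : Subset n) x → degIn G S x ℕ.+ degIn G (compl S) x ≡ deg G x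
degIn-split G S x = count-∧-split S (G x)

toℚ-suc : ∀ n → toℚ (suc n) ≡ toℚ n + 1ℚ
toℚ-suc n = trans (cong toℚ (ℕP.+-comm 1 n)) (toℚ-+ n 1)

complement-internal-at : ∀ {n} (p : ℚ) → 0ℚ < p → (G : Adj n) (S : Subset n) →
  toℚ (count S) ≡ p * toℚ n → ∀ x → G x x ≡ false → S x ≡ true →
  (1ℚ - p) * toℚ (deg G x) ≤ toℚ (degIn G (compl S) x) →
  IsInteger (p * toℚ (deg (complement G) x)) →
  p * toℚ (deg (complement G) x) ≤ toℚ (degIn (complement G) S x)
complement-internal-at {n} p 0<p G S |S|≡pn x loopless x∈S external integral =
  integer-<-suc⇒≤ (degIn (complement G) S x) integral pD<c+1
  where
  D  = toℚ (deg (complement G) x)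
  c  = toℚ (degIn (complement G) S x)
  d  = toℚ (deg G x)
  dS = toℚ (degIn G S x)
  dT = toℚ (degIn G (compl S) x)

  lift₃ : ∀ a b {m} → a ℕ.+ b ℕ.+ 1 ≡ m → toℚ m ≡ toℚ a + toℚ b + 1ℚ
  lift₃ a b refl = trans (toℚ-+ (a ℕ.+ b) 1) (cong (_+ 1ℚ) (toℚ-+ a b))

  n≡D+d+1 : toℚ n ≡ D + d + 1ℚ
  n≡D+d+1 = lift₃ (deg (complement G) x) (deg G x) (deg-complement G x loopless)

  |S|≡c+dS+1 : toℚ (count S) ≡ c + dS + 1ℚ
  |S|≡c+dS+1 = lift₃ (degIn (complement G) S x) (degIn G S x) (degIn-complement-own G x loopless S x∈S)

  d≡dS+dT : d ≡ dS + dT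
  d≡dS+dT = trans (cong toℚ (sym (degIn-split G S x))) (toℚ-+ (degIn G S x) (degIn G (compl S) x))

  slack : p * D + (dT - (1ℚ - p) * d) ≡ c + (1ℚ - p)
  slack = begin
    p * D + (dT - (1ℚ - p) * d)
      ≡⟨ solve 4 (λ p D d dT → p :* D :+ (dT :- (con 1ℚ :- p) :* d) := p :* (D :+ d :+ con 1ℚ) :- (d :- dT) :- p)
               refl p D d dT ⟩
    p * (D + d + 1ℚ) - (d - dT) - p
      ≡⟨ cong₂ (λ a b → a - b - p) (trans (cong (p *_) (sym n≡D+d+1)) (sym |S|≡pn))
                                    (cong (_- dT) d≡dS+dT) ⟩
    toℚ (count S) - (dS + dT - dT) - p
      ≡⟨ cong (λ a → a - (dS + dT - dT) - p) |S|≡c+dS+1 ⟩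
    c + dS + 1ℚ - (dS + dT - dT) - p
      ≡⟨ solve 4 (λ p c dS dT → c :+ dS :+ con 1ℚ :- (dS :+ dT :- dT) :- p := c :+ (con 1ℚ :- p)) refl p c dS dT ⟩
    c + (1ℚ - p) ∎
    where open ≡-Reasoning

  pD<c+1 : p * D < toℚ (suc (degIn (complement G) S x))
  pD<c+1 = begin-strict
    p * D                                     ≡⟨ solve 2 (λ a y → a := a :+ y :- y) refl (p * D) ((1ℚ - p) * d) ⟩
    p * D + (1ℚ - p) * d - (1ℚ - p) * d       ≤⟨ +-monoˡ-≤ (- ((1ℚ - p) * d)) (+-monoʳ-≤ (p * D) external) ⟩
    p * D + dT - (1ℚ - p) * d                 ≡⟨ solve 3 (λ a b y → a :+ b :- y := a :+ (b :- y)) refl (p * D) dT ((1ℚ - p) * d) ⟩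
    p * D + (dT - (1ℚ - p) * d)               ≡⟨ slack ⟩
    c + (1ℚ - p)                              <⟨ +-monoʳ-< c (+-monoʳ-< 1ℚ (neg-antimono-< 0<p)) ⟩
    c + 1ℚ                                    ≡⟨ toℚ-suc (degIn (complement G) S x) ⟨
    toℚ (suc (degIn (complement G) S x))      ∎
    where open ≤-Reasoning

0<1-q : ∀ q → q < 1ℚ → 0ℚ < 1ℚ - q
0<1-q q q<1 = subst (_< 1ℚ - q) (+-inverseʳ q) (+-monoˡ-< (- q) q<1)

degIn-compl-compl : ∀ {n} (G : Adj n) (S : Subset n) x → degIn G S x ≡ degIn G (compl (compl S)) x
degIn-compl-compl G S x = count-cong (λ u → cong (_∧ G x u) (sym (not-involutive (S u))))

proposition3 : (q : ℚ) → 0ℚ < q → q < 1ℚ →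
    (n : ℕ) (G : Adj n) → IsSimple G →
    (A : Subset n) →
    IsExternal (1ℚ - q) G A →
    toℚ (count A) ≡ q * toℚ n →
    toℚ (count (compl A)) ≡ (1ℚ - q) * toℚ n →
    (∀ (v : Fin n) → IsInteger (q * toℚ (deg (complement G) v))) →
    IsInternal q (complement G) A × toℚ (count A) ≡ q * toℚ n
proposition3 q 0<q q<1 n G simple A (nonempty , externalA , externalB) |A|≡qn |B|≡[1-q]n integral =
  (nonempty , internalA , internalB) , |A|≡qn
  where
  open IsSimple simple using (irrefl)
  internalA : ∀ x → A x ≡ true → q * toℚ (deg (complement G) x) ≤ toℚ (degIn (complement G) A x)
  internalA x x∈A =
    complement-internal-at q 0<q G A |A|≡qn x (irrefl x) x∈A (externalA x x∈A) (integral x)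
  internalB : ∀ x → A x ≡ false →
              (1ℚ - q) * toℚ (deg (complement G) x) ≤ toℚ (degIn (complement G) (compl A) x)
  internalB x x∈B =
    complement-internal-at (1ℚ - q) (0<1-q q q<1) G (compl A) |B|≡[1-q]n x (irrefl x) (cong not x∈B)
      (subst (λ k → (1ℚ - (1ℚ - q)) * toℚ (deg G x) ≤ toℚ k) (degIn-compl-compl G A x) (externalB x x∈B))
      (isInteger-[1-q]*n q (deg (complement G) x) (integral x))
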